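{- Let $\mathcal F$ be a pure functional clone algebra with value domain $A$ and trace $\mathsf a$, let $\mathcal G$ be a pure functional clone algebra with value domain $B$ and trace $\mathsf b$, and let $f:F\to G$ be a surjective map with $f(\mathsf e_i^{\mathsf a})=\mathsf e_i^{\mathsf b}$ for all $i$. Let $\mathbf A=(A,\mathsf a,\varphi)_{\varphi\in F}$ and $\mathbf B=(B,\mathsf b,f(\varphi))_{\varphi\in F}$, t-algebras of type $F$. The following are equivalent: (1) $f$ is a uniformly continuous homomorphism from $\mathcal F$ onto $\mathcal G$; (2) for every $s\in\mathsf b$ there exist $n$, $r=(r^1,\dots,r^n)\in\mathsf a^n$ and an onto t-homomorphism $h_s:(\mathbf A^n)_{\bar r}\to\mathbf B_{\bar s}$ such that $h_s\circ\bar r=\bar s\circ f$ on $F$; (3) every t-subalgebra $\mathbf B_{\bar s}$ ($s\in\mathsf b$) of $\mathbf B$ is a t-homomorphic image of a t-subalgebra of a finite t-power of $\mathbf A$.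
   Context: $\mathbb N=\{1,2,\dots\}$. Threads on $A$: elements of $A^{\mathbb N}$; $r[a_1,..,a_n]$ replaces the first $n$ entries of $r$. $r\equiv_{\mathbb N}s$ iff they differ in finitely many entries; $[r]_{\mathbb N}$ its class. A trace on $A$: nonempty union of $\equiv_{\mathbb N}$-classes. For a trace $\mathsf a$ on $A$, $A^{\mathsf a}$ is the set of maps $\mathsf a\to A$; the full pure functional clone algebra on it has $\mathsf e_i^{\mathsf a}(s)=s_i$ and $q_n^{\mathsf a}(\varphi,\psi_1,..,\psi_n)(s)=\varphi(s[\psi_1(s),..,\psi_n(s)])$; a pure functional clone algebra with value domain $A$ and trace $\mathsf a$ is a subalgebra $\mathcal F$ (universe $F$) of it (for the operations $q_n,\mathsf e_i$). A homomorphism between such algebras preserves all $q_n$ and $\mathsf e_i$. A t-algebra of type $\tau$ and trace $\mathsf a$: $(A,\mathsf a,\sigma^{\mathbf A})_{\sigma\in\tau}$ with $\sigma^{\mathbf A}:\mathsf a\to A$ (here $\tau=F$). t-subalgebra: $B\subseteq A$, trace $\mathsf b\subseteq\mathsf a$ on $B$ with $\sigma^{\mathbf A}(\mathsf b)\subseteq B$. t-homomorphism $h$: $h^{\mathbb N}(s)=(h(s_i))_i$ maps trace to trace and $h\circ\sigma=\sigma\circ h^{\mathbb N}$; onto / t-homomorphic image: $h$ and $h^{\mathbb N}$ (between traces) surjective. The t-power $\mathbf A^n$ has universe $A^n$, trace $\mathsf a^n$ (with $(r^1,..,r^n)$ read as the thread $k\mapsto(r^1_k,..,r^n_k)$), operations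 $\varphi(r^1,..,r^n)=(\varphi(r^1),..,\varphi(r^n))$. Terms of type $\tau$: $\mathsf e_i$ and $\sigma(t_1,..,t_m,\mathsf e_{m+1},..)$, with term operations $\mathsf e_i(s)=s_i$, $\sigma(t_1,..,t_m,\mathsf e_{m+1},..)(s)=\sigma(s[t_1(s),..,t_m(s)])$. For a t-algebra $\mathbf C$ and $s$ in its trace, $\mathbf C_{\bar s}$ is the t-subalgebra with universe $C_{\bar s}=\{t^{\mathbf C}(s):t$ a term$\}$ and trace $[s]_{\mathbb N}\cap(C_{\bar s})^{\mathbb N}$. For $r=(r^1,..,r^n)\in\mathsf a^n$, $\bar r:F\to A^n$ is $\bar r(\varphi)=(\varphi(r^1),..,\varphi(r^n))$; for $s\in\mathsf b$, $\bar s:G\to B$ is $\bar s(\psi)=\psi(s)$. The homomorphism $f$ is uniformly continuous if for every $s\in\mathsf b$ there exist $n$ and $r=(r^1,..,r^n)\in\mathsf a^n$ such that for all $\varphi,\psi\in F$, $\bar r(\varphi)=\bar r(\psi)$ implies $f(\varphi)(s)=f(\psi)(s)$. -}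

module Defs where

open import Level using (Level)
open import Data.Nat using (ℕ; zero; suc; _≤_; _<_; _<?_)
open import Data.Fin using (Fin; fromℕ<)
open import Data.Vec using (Vec; lookup; tabulate)
open import Data.Product using (Σ; ∃; _×_; _,_)
open import Relation.Nullary using (yes; no)
open import Relation.Binary.PropositionalEquality using (_≡_)

-- Conventions: ℕ = {0,1,2,...} here; thread index i (and e i) stands for
-- the paper's index i+1.  So a thread on A is a map ℕ → A.

Thread : Set → Set
Thread A = ℕ → A

FinDiff : {A : Set} → Thread A → Thread A → Set
FinDiff r s = Σ ℕ λ N → ∀ i → N ≤ i → r i ≡ s i

record IsTrace {A : Set} (a : Thread A → Set) : Set where
  field
    nonempty : ∃ a
    closed   : ∀ r s → a r → FinDiff r s → a s

record IsTraceOn {A : Set} (U : A → Set) (T : Thread A → Set) : Set where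
  field
    nonempty : ∃ T
    inU      : ∀ r → T r → ∀ i → U (r i)
    closed   : ∀ r s → T r → (∀ i → U (s i)) → FinDiff r s → T s

upd : {A : Set} → Thread A → (n : ℕ) → (Fin n → A) → Thread A
upd s n v i with i <? n
... | yes p = v (fromℕ< p)
... | no _  = s i

-- An element of A^𝖺 is represented by a map Op A = Thread A → A, of which
-- only the values on the trace matter; two representatives are equal iff
-- they agree on the trace.

Op : Set → Set
Op A = Thread A → A

_≈[_]_ : {A : Set} → Op A → (Thread A → Set) → Op A → Set
φ ≈[ a ] ψ = ∀ s → a s → φ s ≡ ψ s

e : {A : Set} → ℕ → Op A
e i s = s i

q : {A : Set} → (n : ℕ) → Op A → (Fin n → Op A) → Op A
q n φ ψ s = φ (upd s n (λ k → ψ k s))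

record IsPFCA {A : Set} (a : Thread A → Set) (F : Op A → Set) : Set where
  field
    isTrace : IsTrace a
    -- F is a subset of the quotient: closed under agreement on the trace
    F-resp  : ∀ φ ψ → φ ≈[ a ] ψ → F φ → F ψ
    -- elements are genuine maps on 𝖺 (pointwise-equal threads give equal values)
    F-ext   : ∀ φ → F φ → ∀ s s' → a s → (∀ i → s i ≡ s' i) → φ s ≡ φ s'
    F-e     : ∀ i → F (e i)
    F-q     : ∀ n φ ψ → F φ → (∀ k → F (ψ k)) → F (q n φ ψ)

record TAlg (τ : Set) : Set₁ where
  field
    Carrier : Set
    trace   : Thread Carrier → Set
    op      : τ → Thread Carrier → Carrier

open TAlg public

tpow : {τ : Set} → TAlg τ → ℕ → TAlg τ
tpow C n = record
  { Carrier = Vec (Carrier C) n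
  ; trace   = λ u → ∀ j → trace C (λ k → lookup (u k) j)
  ; op      = λ σ u → tabulate (λ j → op C σ (λ k → lookup (u k) j))
  }

-- terms of type τ: e_i and σ(t_1,...,t_m, e_{m+1}, ...)
data Term (τ : Set) : Set where
  var : ℕ → Term τ
  app : τ → (m : ℕ) → (Fin m → Term τ) → Term τ

eval : {τ : Set} (C : TAlg τ) → Term τ → Thread (Carrier C) → Carrier C
eval C (var i)      s = s i
eval C (app σ m ts) s = op C σ (upd s m (λ k → eval C (ts k) s))

GenU : {τ : Set} (C : TAlg τ) → Thread (Carrier C) → Carrier C → Set
GenU C s x = Σ (Term _) λ t → eval C t s ≡ x

GenT : {τ : Set} (C : TAlg τ) → Thread (Carrier C) → Thread (Carrier C) → Set
GenT C s v = FinDiff s v × (∀ i → GenU C s (v i))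

record IsTSub {τ : Set} (C : TAlg τ) (U : Carrier C → Set)
              (T : Thread (Carrier C) → Set) : Set where
  field
    T⊆trace : ∀ v → T v → trace C v
    isTrace : IsTraceOn U T
    closed  : ∀ σ v → T v → U (op C σ v)

-- h : (C,U,T) → (D,V,W) is an onto t-homomorphism.  h is a map defined on
-- U (it may inspect the membership proof, but its value may not depend on it).
record IsOntoTHom {τ : Set} (C : TAlg τ) (U : Carrier C → Set)
                  (T : Thread (Carrier C) → Set)
                  (D : TAlg τ) (V : Carrier D → Set)
                  (W : Thread (Carrier D) → Set)
                  (h : (x : Carrier C) → U x → Carrier D) : Set where
  field
    wd    : ∀ x p p' → h x p ≡ h x p'
    h-in  : ∀ x p → V (h x p)
    hN-in : ∀ v (pv : ∀ i → U (v i)) → T v → W (λ i → h (v i) (pv i))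
    hom   : ∀ σ v (pv : ∀ i → U (v i)) → T v → (p : U (op C σ v)) →
            h (op C σ v) p ≡ op D σ (λ i → h (v i) (pv i))
    onto  : ∀ y → V y → Σ (Carrier C) λ x → Σ (U x) λ p → h x p ≡ y
    ontoN : ∀ w → W w → Σ (Thread (Carrier C)) λ v →
              Σ (∀ i → U (v i)) λ pv → T v × (∀ i → h (v i) (pv i) ≡ w i)

module Setting {A B : Set} (a : Thread A → Set) (b : Thread B → Set)
               (F : Op A → Set) (G : Op B → Set)
               (f : (φ : Op A) → F φ → Op B) where

  τ : Set
  τ = Σ (Op A) F

  𝐀 : TAlg τ
  𝐀 = record { Carrier = A ; trace = a ; op = λ { (φ , p) → φ } }

  𝐁 : TAlg τ
  𝐁 = record { Carrier = B ; trace = b ; op = λ { (φ , p) → f φ p } }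

  rthread : {n : ℕ} → (Fin n → Thread A) → Thread (Vec A n)
  rthread r k = tabulate (λ j → r j k)

  rbar : {n : ℕ} → (Fin n → Thread A) → Op A → Vec A n
  rbar r φ = tabulate (λ j → φ (r j))

  IsHom : (isF : IsPFCA a F) → Set
  IsHom isF = ∀ n φ (p : F φ) (ψ : Fin n → Op A) (ps : ∀ k → F (ψ k)) →
              f (q n φ ψ) (IsPFCA.F-q isF n φ ψ p ps)
                ≈[ b ] q n (f φ p) (λ k → f (ψ k) (ps k))

  UnifCont : Set
  UnifCont = ∀ s → b s → Σ ℕ λ n → 1 ≤ n × Σ (Fin n → Thread A) λ r →
             (∀ j → a (r j)) ×
             (∀ φ ψ (p : F φ) (p' : F ψ) → rbar r φ ≡ rbar r ψ → f φ p s ≡ f ψ p' s)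

  Cond1 : (isF : IsPFCA a F) → Set
  Cond1 isF = IsHom isF × UnifCont

  Cond2 : Set
  Cond2 = ∀ s → b s → Σ ℕ λ n → 1 ≤ n × Σ (Fin n → Thread A) λ r →
          (∀ j → a (r j)) ×
          Σ ((x : Vec A n) → GenU (tpow 𝐀 n) (rthread r) x → B) λ h →
            IsOntoTHom (tpow 𝐀 n) (GenU (tpow 𝐀 n) (rthread r)) (GenT (tpow 𝐀 n) (rthread r))
                       𝐁 (GenU 𝐁 s) (GenT 𝐁 s) h ×
            (∀ φ (p : F φ) (u : GenU (tpow 𝐀 n) (rthread r) (rbar r φ)) →
               h (rbar r φ) u ≡ f φ p s)

  Cond3 : Set₁
  Cond3 = ∀ s → b s → Σ ℕ λ n → 1 ≤ n ×
          Σ (Vec A n → Set) λ U → Σ (Thread (Vec A n) → Set) λ T →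
          IsTSub (tpow 𝐀 n) U T ×
          Σ ((x : Vec A n) → U x → B) λ h →
            IsOntoTHom (tpow 𝐀 n) U T 𝐁 (GenU 𝐁 s) (GenT 𝐁 s) h

-- A homomorphism f sends the term operation ⟦ t ⟧ of ℱ to the interpretation
-- of t in 𝐁, while in 𝐀ⁿ the term t evaluated at the thread r is r̄(⟦ t ⟧).
-- So uniform continuity at s says precisely that t^{𝐀ⁿ}(r) ↦ t^𝐁(s) is well
-- defined, and this map is an onto t-homomorphism (𝐀ⁿ)_r̄ → 𝐁_s̄.  Conversely,
-- given an onto t-homomorphism h from a t-subalgebra of 𝐀ⁿ onto 𝐁_s̄, choose a
-- thread v with h ∘ v = s and let r be the coordinate threads of v; then
-- f(φ)(s) = h(r̄(φ)), which yields uniform continuity and the homomorphism law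
-- at s.
{-# OPTIONS --safe #-}
module Submission where

open import Defs
open import Data.Nat using (ℕ; _≤_; _<?_; _+_)
open import Data.Nat.Properties using (<⇒≱; ≮⇒≥; m≤m+n; m≤n+m; ≤-trans)
open import Data.Fin using (Fin; toℕ; fromℕ<)
open import Data.Fin.Properties using (toℕ-fromℕ<)
open import Data.Vec using (Vec; lookup; tabulate)
open import Data.Vec.Properties using (lookup∘tabulate; tabulate∘lookup; tabulate-cong)
open import Data.Product using (Σ; _×_; _,_; proj₁; proj₂)
open import Data.Empty using (⊥-elim)
open import Function using (_∘_)
open import Relation.Nullary using (yes; no)
open import Relation.Binary.PropositionalEquality
  using (_≡_; refl; sym; trans; cong; module ≡-Reasoning)

open ≡-Reasoning

module _ {X : Set} where

  FinDiff-refl : {s : Thread X} → FinDiff s s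
  FinDiff-refl = 0 , λ _ _ → refl

  FinDiff-trans : {r s t : Thread X} → FinDiff r s → FinDiff s t → FinDiff r t
  FinDiff-trans (M , r≗s) (N , s≗t) = M + N , λ i le →
    trans (r≗s i (≤-trans (m≤m+n M N) le)) (s≗t i (≤-trans (m≤n+m N M) le))

  upd-≥ : (s : Thread X) (m : ℕ) (v : Fin m → X) → ∀ i → m ≤ i → upd s m v i ≡ s i
  upd-≥ s m v i m≤i with i <? m
  ... | yes i<m = ⊥-elim (<⇒≱ i<m m≤i)
  ... | no _    = refl

  FinDiff-upd : (s : Thread X) (m : ℕ) (v : Fin m → X) → FinDiff s (upd s m v)
  FinDiff-upd s m v = m , λ i le → sym (upd-≥ s m v i le)

  upd-∈trace : {a : Thread X → Set} → IsTrace a →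
               ∀ {s} m (v : Fin m → X) → a s → a (upd s m v)
  upd-∈trace isTrace m v as = IsTrace.closed isTrace _ _ as (FinDiff-upd _ m v)

  upd-toℕ : (s : Thread X) (m : ℕ) (g : Thread X) → (∀ i → m ≤ i → s i ≡ g i) →
            ∀ i → upd s m (g ∘ toℕ) i ≡ g i
  upd-toℕ s m g s≗g i with i <? m
  ... | yes i<m = cong g (toℕ-fromℕ< i<m)
  ... | no i≮m  = s≗g i (≮⇒≥ i≮m)

upd-pointwise : {X Y : Set} (R : X → Y → Set) (s : Thread X) (s' : Thread Y) (m : ℕ)
                (v : Fin m → X) (v' : Fin m → Y) →
                (∀ k → R (v k) (v' k)) → (∀ i → m ≤ i → R (s i) (s' i)) →
                ∀ i → R (upd s m v i) (upd s' m v' i)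
upd-pointwise R s s' m v v' Rv Rs i with i <? m
... | yes i<m = Rv (fromℕ< i<m)
... | no i≮m  = Rs i (≮⇒≥ i≮m)

upd-cong : {X : Set} (s : Thread X) (m : ℕ) {v v' : Fin m → X} →
           (∀ k → v k ≡ v' k) → ∀ i → upd s m v i ≡ upd s m v' i
upd-cong s m v≗v' = upd-pointwise _≡_ s s m _ _ v≗v' (λ _ _ → refl)

module _ {τ : Set} (C : TAlg τ) where

  ExtensionalAt : Thread (Carrier C) → Set
  ExtensionalAt R = ∀ σ u u' → FinDiff R u → (∀ i → u i ≡ u' i) → op C σ u ≡ op C σ u'

  GenT-refl : (s : Thread (Carrier C)) → GenT C s s
  GenT-refl s = FinDiff-refl , λ i → var i , refl

  tpow-trace-closed : (∀ r s → trace C r → FinDiff r s → trace C s) →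
                      ∀ {n} {u w : Thread (Vec (Carrier C) n)} →
                      trace (tpow C n) u → FinDiff u w → trace (tpow C n) w
  tpow-trace-closed closed tu (N , u≗w) j =
    closed _ _ (tu j) (N , λ i le → cong (λ x → lookup x j) (u≗w i le))

  GenU-op : ∀ {R} → ExtensionalAt R → ∀ σ v → GenT C R v → GenU C R (op C σ v)
  GenU-op {R} ext σ v ((N , R≗v) , v∈U) =
    app σ N (t ∘ toℕ) , ext σ _ v (FinDiff-upd R N _) upd≗v
    where
    t : ℕ → Term τ
    t i = proj₁ (v∈U i)
    upd≗v : ∀ i → upd R N (λ k → eval C (t (toℕ k)) R) i ≡ v i
    upd≗v i = trans (upd-toℕ R N (λ i → eval C (t i) R)
                       (λ i le → trans (R≗v i le) (sym (proj₂ (v∈U i)))) i)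
                    (proj₂ (v∈U i))

  generated-isTSub : ∀ {R} → (∀ u → FinDiff R u → trace C u) → ExtensionalAt R →
                     IsTSub C (GenU C R) (GenT C R)
  generated-isTSub {R} [R]⊆trace ext = record
    { T⊆trace = λ v v∈T → [R]⊆trace v (proj₁ v∈T)
    ; isTrace = record
        { nonempty = R , GenT-refl R
        ; inU      = λ v v∈T → proj₂ v∈T
        ; closed   = λ v w v∈T w∈U v≗w → FinDiff-trans (proj₁ v∈T) v≗w , w∈U }
    ; closed  = GenU-op ext }

termMap : {τ : Set} (C D : TAlg τ) (R : Thread (Carrier C)) (s : Thread (Carrier D)) →
          (x : Carrier C) → GenU C R x → Carrier D
termMap C D R s x (t , _) = eval D t s

module _ {τ : Set} (C D : TAlg τ) (R : Thread (Carrier C)) (s : Thread (Carrier D))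
         (extC : ExtensionalAt C R) (extD : ExtensionalAt D s)
         (respects : ∀ t t' → eval C t R ≡ eval C t' R → eval D t s ≡ eval D t' s) where

  private
    s≗termMap : (v : Thread (Carrier C)) (v∈U : ∀ i → GenU C R (v i)) {N : ℕ} →
                (∀ i → N ≤ i → R i ≡ v i) →
                ∀ i → N ≤ i → s i ≡ termMap C D R s (v i) (v∈U i)
    s≗termMap v v∈U R≗v i le =
      respects (var i) (proj₁ (v∈U i)) (trans (R≗v i le) (sym (proj₂ (v∈U i))))

    termMap-hom : ∀ σ v (v∈U : ∀ i → GenU C R (v i)) → GenT C R v → (c : GenU C R (op C σ v)) →
                  termMap C D R s (op C σ v) c ≡ op D σ (λ i → termMap C D R s (v i) (v∈U i))
    termMap-hom σ v v∈U ((N , R≗v) , _) (t₀ , t₀≡) = begin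
        eval D t₀ s
      ≡⟨ respects t₀ (proj₁ σv∈U) (trans t₀≡ (sym (proj₂ σv∈U))) ⟩
        op D σ (upd s N (λ k → termMap C D R s (v (toℕ k)) (v∈U (toℕ k))))
      ≡⟨ extD σ _ _ (FinDiff-upd s N _)
           (upd-toℕ s N (λ i → termMap C D R s (v i) (v∈U i)) (s≗termMap v v∈U R≗v)) ⟩
        op D σ (λ i → termMap C D R s (v i) (v∈U i)) ∎
      where
      σv∈U : GenU C R (op C σ v)
      σv∈U = GenU-op C extC σ v ((N , R≗v) , v∈U)

    termMap-ontoN : ∀ w → GenT D s w → Σ (Thread (Carrier C)) λ v →
                    Σ (∀ i → GenU C R (v i)) λ v∈U →
                    GenT C R v × (∀ i → termMap C D R s (v i) (v∈U i) ≡ w i)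
    termMap-ontoN w ((N , s≗w) , w∈U) =
      (λ i → eval C (ts i) R) , v∈U , ((N , R≗v) , v∈U) , evalts≗w
      where
      ts : ℕ → Term τ
      ts = upd var N (λ k → proj₁ (w∈U (toℕ k)))
      v∈U : ∀ i → GenU C R (eval C (ts i) R)
      v∈U i = ts i , refl
      R≗v : ∀ i → N ≤ i → R i ≡ eval C (ts i) R
      R≗v i le = cong (λ t → eval C t R) (sym (upd-≥ var N _ i le))
      evalts≗w : ∀ i → eval D (ts i) s ≡ w i
      evalts≗w i = trans
        (upd-pointwise (λ t y → eval D t s ≡ y) var w N _ (w ∘ toℕ)
                       (λ k → proj₂ (w∈U (toℕ k))) s≗w i)
        (upd-toℕ w N w (λ _ _ → refl) i)

  termMap-isOntoTHom : IsOntoTHom C (GenU C R) (GenT C R) D (GenU D s) (GenT D s) (termMap C D R s)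
  termMap-isOntoTHom = record
    { wd    = λ { x (t , t≡x) (t' , t'≡x) → respects t t' (trans t≡x (sym t'≡x)) }
    ; h-in  = λ { x (t , _) → t , refl }
    ; hN-in = λ { v v∈U ((N , R≗v) , _) →
                  (N , s≗termMap v v∈U R≗v) , λ i → proj₁ (v∈U i) , refl }
    ; hom   = termMap-hom
    ; onto  = λ { y (t , t≡y) → eval C t R , (t , refl) , t≡y }
    ; ontoN = termMap-ontoN }

module Clone {A : Set} {a : Thread A → Set} {F : Op A → Set} (isF : IsPFCA a F) where
  open IsPFCA isF

  𝐀 : TAlg (Σ (Op A) F)
  𝐀 = record { Carrier = A ; trace = a ; op = λ { (φ , p) → φ } }

  liftⁿ : {n : ℕ} → Op A → Thread (Vec A n) → Vec A n
  liftⁿ φ u = tabulate (λ j → φ (λ k → lookup (u k) j))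

  traceⁿ-closed : ∀ {n} {u w : Thread (Vec A n)} →
                  trace (tpow 𝐀 n) u → FinDiff u w → trace (tpow 𝐀 n) w
  traceⁿ-closed = tpow-trace-closed 𝐀 (IsTrace.closed isTrace)

  liftⁿ-cong : ∀ {n φ} {u u' : Thread (Vec A n)} → F φ → trace (tpow 𝐀 n) u →
               (∀ i → u i ≡ u' i) → liftⁿ φ u ≡ liftⁿ φ u'
  liftⁿ-cong p tu u≗u' =
    tabulate-cong (λ j → F-ext _ p _ _ (tu j) (λ k → cong (λ x → lookup x j) (u≗u' k)))

  tpow-extensional : ∀ {n} {R : Thread (Vec A n)} → trace (tpow 𝐀 n) R → ExtensionalAt (tpow 𝐀 n) R
  tpow-extensional tR (φ , p) u u' R≗u = liftⁿ-cong p (traceⁿ-closed tR R≗u)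

  liftⁿ-q : ∀ {n m φ} (ψ : Fin m → Op A) {u : Thread (Vec A n)} → F φ → trace (tpow 𝐀 n) u →
            liftⁿ (q m φ ψ) u ≡ liftⁿ φ (upd u m (λ k → liftⁿ (ψ k) u))
  liftⁿ-q {m = m} {φ} ψ {u} p tu = tabulate-cong λ j →
    F-ext φ p _ _ (upd-∈trace isTrace m _ (tu j))
      (upd-pointwise (λ x y → x ≡ lookup y j) _ u m _ _
        (λ k → sym (lookup∘tabulate _ j)) (λ _ _ → refl))

  ⟦_⟧ : Term (Σ (Op A) F) → Op A
  ⟦ var i ⟧          = e i
  ⟦ app (φ , _) m ts ⟧ = q m φ (λ k → ⟦ ts k ⟧)

  ⟦⟧∈F : ∀ t → F ⟦ t ⟧
  ⟦⟧∈F (var i)            = F-e i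
  ⟦⟧∈F (app (φ , p) m ts) = F-q m φ _ p (λ k → ⟦⟧∈F (ts k))

  eval-tpow : ∀ {n} t {u : Thread (Vec A n)} → trace (tpow 𝐀 n) u →
              eval (tpow 𝐀 n) t u ≡ liftⁿ ⟦ t ⟧ u
  eval-tpow (var i) {u} _ = sym (tabulate∘lookup (u i))
  eval-tpow {n} (app (φ , p) m ts) {u} tu = begin
      liftⁿ φ (upd u m (λ k → eval (tpow 𝐀 n) (ts k) u))
    ≡⟨ liftⁿ-cong p (traceⁿ-closed tu (FinDiff-upd u m _))
                     (upd-cong u m (λ k → eval-tpow (ts k) tu)) ⟩
      liftⁿ φ (upd u m (λ k → liftⁿ ⟦ ts k ⟧ u))
    ≡⟨ sym (liftⁿ-q (λ k → ⟦ ts k ⟧) p tu) ⟩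
      liftⁿ ⟦ app (φ , p) m ts ⟧ u ∎

module Equivalence {A B : Set} {a : Thread A → Set} {b : Thread B → Set}
                   {F : Op A → Set} {G : Op B → Set} (isF : IsPFCA a F) (isG : IsPFCA b G)
                   (f : (φ : Op A) → F φ → Op B) (f-in : ∀ φ p → G (f φ p))
                   (f-e : ∀ i p → f (e i) p ≈[ b ] e i) where
  open Setting a b F G f using (𝐁; rthread; rbar; IsHom; UnifCont; Cond1; Cond2; Cond3)
  open Clone isF
  open IsPFCA isF using (F-ext; F-e; F-q)
  private
    isTraceᵇ : IsTrace b
    isTraceᵇ = IsPFCA.isTrace isG

  f-ext : ∀ φ p {s s'} → b s → (∀ i → s i ≡ s' i) → f φ p s ≡ f φ p s'
  f-ext φ p = IsPFCA.F-ext isG (f φ p) (f-in φ p) _ _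

  𝐁-extensional : ∀ {s} → b s → ExtensionalAt 𝐁 s
  𝐁-extensional bs (φ , p) u u' s≗u = f-ext φ p (IsTrace.closed isTraceᵇ _ u bs s≗u)

  eval-𝐁 : IsHom isF → ∀ t {s} → b s → eval 𝐁 t s ≡ f ⟦ t ⟧ (⟦⟧∈F t) s
  eval-𝐁 hom (var i) bs = sym (f-e i (F-e i) _ bs)
  eval-𝐁 hom (app (φ , p) m ts) {s} bs = begin
      f φ p (upd s m (λ k → eval 𝐁 (ts k) s))
    ≡⟨ f-ext φ p (upd-∈trace isTraceᵇ m _ bs) (upd-cong s m (λ k → eval-𝐁 hom (ts k) bs)) ⟩
      f φ p (upd s m (λ k → f ⟦ ts k ⟧ (⟦⟧∈F (ts k)) s))
    ≡⟨ sym (hom m φ p _ _ s bs) ⟩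
      f ⟦ app (φ , p) m ts ⟧ (⟦⟧∈F (app (φ , p) m ts)) s ∎

  rthread∈trace : ∀ {n} {r : Fin n → Thread A} → (∀ j → a (r j)) → trace (tpow 𝐀 n) (rthread r)
  rthread∈trace ra j =
    IsTrace.closed (IsPFCA.isTrace isF) _ _ (ra j) (0 , λ i _ → sym (lookup∘tabulate _ j))

  eval-rthread : ∀ {n} {r : Fin n → Thread A} → (∀ j → a (r j)) →
                 ∀ t → eval (tpow 𝐀 n) t (rthread r) ≡ rbar r ⟦ t ⟧
  eval-rthread {r = r} ra t = trans (eval-tpow t (rthread∈trace ra)) liftⁿ≡rbar
    where
    liftⁿ≡rbar : liftⁿ ⟦ t ⟧ (rthread r) ≡ rbar r ⟦ t ⟧
    liftⁿ≡rbar = tabulate-cong λ j →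
      F-ext _ (⟦⟧∈F t) _ _ (rthread∈trace ra j) (λ k → lookup∘tabulate _ j)

  cond1⇒cond2 : Cond1 isF → Cond2
  cond1⇒cond2 (hom , uc) s bs with uc s bs
  ... | n , 1≤n , r , ra , rbar≡⇒f≡ =
    n , 1≤n , r , ra , termMap (tpow 𝐀 n) 𝐁 (rthread r) s ,
    termMap-isOntoTHom (tpow 𝐀 n) 𝐁 (rthread r) s
      (tpow-extensional (rthread∈trace ra)) (𝐁-extensional bs) respects ,
    commutes
    where
    respects : ∀ t t' → eval (tpow 𝐀 n) t (rthread r) ≡ eval (tpow 𝐀 n) t' (rthread r) →
               eval 𝐁 t s ≡ eval 𝐁 t' s
    respects t t' eq = begin
        eval 𝐁 t s
      ≡⟨ eval-𝐁 hom t bs ⟩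
        f ⟦ t ⟧ _ s
      ≡⟨ rbar≡⇒f≡ _ _ _ _ (trans (sym (eval-rthread ra t)) (trans eq (eval-rthread ra t'))) ⟩
        f ⟦ t' ⟧ _ s
      ≡⟨ sym (eval-𝐁 hom t' bs) ⟩
        eval 𝐁 t' s ∎
    commutes : ∀ φ p (c : GenU (tpow 𝐀 n) (rthread r) (rbar r φ)) →
               termMap (tpow 𝐀 n) 𝐁 (rthread r) s (rbar r φ) c ≡ f φ p s
    commutes φ p (t , t≡) =
      trans (eval-𝐁 hom t bs) (rbar≡⇒f≡ _ _ _ _ (trans (sym (eval-rthread ra t)) t≡))

  cond2⇒cond3 : Cond2 → Cond3
  cond2⇒cond3 c2 s bs with c2 s bs
  ... | n , 1≤n , r , ra , h , isOntoTHom , _ =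
    n , 1≤n , _ , _ ,
    generated-isTSub (tpow 𝐀 n) (λ u → traceⁿ-closed (rthread∈trace ra))
      (tpow-extensional (rthread∈trace ra)) ,
    h , isOntoTHom

  module FromOntoTHom {n : ℕ} {U : Vec A n → Set} {T : Thread (Vec A n) → Set}
                      (sub : IsTSub (tpow 𝐀 n) U T)
                      {h : (x : Vec A n) → U x → B} {s : Thread B} (bs : b s)
                      (H : IsOntoTHom (tpow 𝐀 n) U T 𝐁 (GenU 𝐁 s) (GenT 𝐁 s) h) where
    open IsOntoTHom H
    open IsTSub sub

    h-cong : ∀ {x y} → x ≡ y → (px : U x) (py : U y) → h x px ≡ h y py
    h-cong refl = wd _

    private
      preimage : Σ (Thread (Vec A n)) λ v → Σ (∀ i → U (v i)) λ v∈U →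
                 T v × (∀ i → h (v i) (v∈U i) ≡ s i)
      preimage = ontoN s (GenT-refl 𝐁 s)

    v : Thread (Vec A n)
    v = proj₁ preimage

    v∈U : ∀ i → U (v i)
    v∈U = proj₁ (proj₂ preimage)

    v∈T : T v
    v∈T = proj₁ (proj₂ (proj₂ preimage))

    hv≗s : ∀ i → h (v i) (v∈U i) ≡ s i
    hv≗s = proj₂ (proj₂ (proj₂ preimage))

    r : Fin n → Thread A
    r j k = lookup (v k) j

    -- r is chosen so that rbar r φ is definitionally liftⁿ φ v, the operation φ of 𝐀ⁿ at v.
    f≡h∘rbar : ∀ φ p (c : U (rbar r φ)) → f φ p s ≡ h (rbar r φ) c
    f≡h∘rbar φ p c = trans (f-ext φ p bs (λ i → sym (hv≗s i))) (sym (hom (φ , p) v v∈U v∈T c))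

    uniformlyContinuous : ∀ φ ψ (p : F φ) (p' : F ψ) → rbar r φ ≡ rbar r ψ → f φ p s ≡ f ψ p' s
    uniformlyContinuous φ ψ p p' eq = begin
        f φ p s                     ≡⟨ f≡h∘rbar φ p c ⟩
        h (rbar r φ) c              ≡⟨ h-cong eq c c' ⟩
        h (rbar r ψ) c'             ≡⟨ sym (f≡h∘rbar ψ p' c') ⟩
        f ψ p' s                    ∎
      where
      c : U (rbar r φ)
      c  = closed (φ , p) v v∈T
      c' : U (rbar r ψ)
      c' = closed (ψ , p') v v∈T

    homomorphic : ∀ m φ (p : F φ) (ψ : Fin m → Op A) (ps : ∀ k → F (ψ k)) →
                  f (q m φ ψ) (F-q m φ ψ p ps) s ≡ q m (f φ p) (λ k → f (ψ k) (ps k)) s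
    homomorphic m φ p ψ ps = begin
        f (q m φ ψ) (F-q m φ ψ p ps) s
      ≡⟨ f≡h∘rbar _ _ c ⟩
        h (rbar r (q m φ ψ)) c
      ≡⟨ h-cong (liftⁿ-q ψ p (T⊆trace v v∈T)) c (closed (φ , p) v' v'∈T) ⟩
        h (liftⁿ φ v') _
      ≡⟨ hom (φ , p) v' v'∈U v'∈T _ ⟩
        f φ p (λ i → h (v' i) (v'∈U i))
      ≡⟨ sym (f-ext φ p (upd-∈trace isTraceᵇ m _ bs) (λ i → sym (hv'≗ i (v'∈U i)))) ⟩
        f φ p (upd s m (λ k → f (ψ k) (ps k) s)) ∎
      where
      c : U (rbar r (q m φ ψ))
      c = closed (q m φ ψ , F-q m φ ψ p ps) v v∈T
      v' : Thread (Vec A n)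
      v' = upd v m (λ k → rbar r (ψ k))
      v'∈U : ∀ i → U (v' i)
      v'∈U = upd-pointwise (λ x _ → U x) v v m (λ k → rbar r (ψ k)) (λ k → rbar r (ψ k))
               (λ k → closed (ψ k , ps k) v v∈T) (λ i _ → v∈U i)
      v'∈T : T v'
      v'∈T = IsTraceOn.closed isTrace v v' v∈T v'∈U (FinDiff-upd v m _)
      hv'≗ : ∀ i (px : U (v' i)) → h (v' i) px ≡ upd s m (λ k → f (ψ k) (ps k) s) i
      hv'≗ = upd-pointwise (λ x y → (px : U x) → h x px ≡ y) v s m _ _
        (λ k px → trans (wd _ px (closed (ψ k , ps k) v v∈T)) (sym (f≡h∘rbar (ψ k) (ps k) _)))
        (λ i _ px → trans (wd _ px (v∈U i)) (hv≗s i))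

  cond3⇒cond1 : Cond3 → Cond1 isF
  cond3⇒cond1 c3 = homomorphic , uniformlyContinuous
    where
    homomorphic : IsHom isF
    homomorphic m φ p ψ ps s bs with c3 s bs
    ... | _ , _ , _ , _ , sub , _ , H = FromOntoTHom.homomorphic sub bs H m φ p ψ ps
    uniformlyContinuous : UnifCont
    uniformlyContinuous s bs with c3 s bs
    ... | n , 1≤n , _ , _ , sub , _ , H =
      n , 1≤n , FromOntoTHom.r sub bs H , T⊆trace (FromOntoTHom.v sub bs H) (FromOntoTHom.v∈T sub bs H) ,
      FromOntoTHom.uniformlyContinuous sub bs H
      where open IsTSub sub

theorem14p4 : {A B : Set} (a : Thread A → Set) (b : Thread B → Set)
              (F : Op A → Set) (G : Op B → Set)
              (isF : IsPFCA a F) (isG : IsPFCA b G)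
              (f : (φ : Op A) → F φ → Op B)
              -- f is a well-defined map F → G
              (f-in : ∀ φ p → G (f φ p))
              (f-wd : ∀ φ ψ p p' → φ ≈[ a ] ψ → f φ p ≈[ b ] f ψ p')
              -- f is surjective
              (f-onto : ∀ ψ → G ψ → Σ (Op A) λ φ → Σ (F φ) λ p → f φ p ≈[ b ] ψ)
              -- f(e_i) = e_i
              (f-e : ∀ i p → f (e i) p ≈[ b ] e i) →
              let open Setting a b F G f in
              ((Cond1 isF → Cond2) × (Cond2 → Cond1 isF)) ×
              ((Cond2 → Cond3) × (Cond3 → Cond2))
theorem14p4 a b F G isF isG f f-in _ _ f-e =
  (cond1⇒cond2 , cond3⇒cond1 ∘ cond2⇒cond3) , (cond2⇒cond3 , cond1⇒cond2 ∘ cond3⇒cond1)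
  where open Equivalence isF isG f f-in f-e
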